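{- Let $q$ be a prime, $G=(\mathbb Z/q\mathbb Z)^*$, and $a\in G$ an element other than the identity. Write $\mathscr P_{a,q}=p^r$ with $p$ prime, and put $G_r=\mathbb Z/p^r\mathbb Z$. Then there exists a generator $g$ of $G$ such that the map $n\mapsto g^n$ defines a group isomorphism $\phi_g:G_r\to G/H(a)$ sending the class $p^{r-1}\pmod{p^r}$ to the coset $aH(a)$.
   Context: Write $q-1=\prod_{j=1}^k p_j^{\alpha_j}$ and $\mathrm{ord}_q(a)=\prod_{j=1}^s p_j^{\beta_j}$ (prime factorizations, $p_j$ distinct, $s\le k$, $\alpha_j,\beta_j\ge1$). Then $\mathscr P_{a,q}=\min_{1\le j\le s}p_j^{\alpha_j-\beta_j+1}$, a prime power. $H(a)$ is the subgroup of largest cardinality among subgroups of the cyclic group $G$ not containing $a$; equivalently, the unique subgroup of $G$ of order $(q-1)/\mathscr P_{a,q}$. -}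

module Defs where

open import Data.Nat using (ℕ; zero; suc; _+_; _*_; _∸_; _^_; _≤_; _<_)
open import Data.Nat.Divisibility using (_∣_)
open import Data.Nat.Primality using (Prime)
open import Data.Integer as ℤ using (ℤ; +_)
open import Data.Integer.Divisibility as ℤD using ()
open import Data.List using (List; length)
open import Data.List.Membership.Propositional using (_∈_)
open import Data.List.Relation.Unary.Unique.Propositional using (Unique)
open import Data.Product using (Σ; ∃; _×_; _,_)
open import Relation.Nullary using (¬_)
open import Function.Bundles using (_⇔_)
open import Relation.Binary.PropositionalEquality as PE using ()

infix 4 _≡_[mod_]
_≡_[mod_] : ℕ → ℕ → ℕ → Set
x ≡ y [mod n ] = (+ n) ℤD.∣ ((+ x) ℤ.- (+ y))

-- The group G = (ℤ/qℤ)^*, elements represented by naturals 1 ≤ x < q.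
InG : ℕ → ℕ → Set
InG q x = 1 ≤ x × x < q

IsOrd : ℕ → ℕ → ℕ → Set
IsOrd q a o = 1 ≤ o × (a ^ o ≡ 1 [mod q ]) ×
  (∀ k → 1 ≤ k → k < o → ¬ (a ^ k ≡ 1 [mod q ]))

IsVal : ℕ → ℕ → ℕ → Set
IsVal p n e = (p ^ e ∣ n) × ¬ (p ^ suc e ∣ n)

IsScriptP : ℕ → ℕ → ℕ → Set
IsScriptP q a P = Σ ℕ λ o → IsOrd q a o ×
  (Σ ℕ λ p → Σ ℕ λ α → Σ ℕ λ β →
     Prime p × p ∣ o × IsVal p (q ∸ 1) α × IsVal p o β × P PE.≡ p ^ (α ∸ β + 1)) ×
  (∀ p α β → Prime p → p ∣ o → IsVal p (q ∸ 1) α → IsVal p o β →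
     P ≤ p ^ (α ∸ β + 1))

-- A subgroup of G, given as a predicate on representatives, closed under
-- congruence mod q.
record IsSubgroup (q : ℕ) (H : ℕ → Set) : Set where
  field
    resp  : ∀ {x y} → x ≡ y [mod q ] → H x → H y
    inG   : ∀ {x} → H x → ¬ (q ∣ x)
    one   : H 1
    mul   : ∀ {x y} → H x → H y → H (x * y)
    inv   : ∀ {x} → H x → Σ ℕ λ y → H y × (x * y ≡ 1 [mod q ])

HasCard : ℕ → (ℕ → Set) → ℕ → Set
HasCard q H m = Σ (List ℕ) λ xs → Unique xs × length xs PE.≡ m ×
  (∀ x → (x ∈ xs) ⇔ (InG q x × H x))

IsGenerator : ℕ → ℕ → Set
IsGenerator q g = InG q g × (∀ x → InG q x → Σ ℕ λ n → g ^ n ≡ x [mod q ])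

SameCoset : ℕ → (ℕ → Set) → ℕ → ℕ → Set
SameCoset q H x y = Σ ℕ λ h → H h × (x ≡ y * h [mod q ])

IsIsoPhi : ℕ → (ℕ → Set) → ℕ → ℕ → Set
IsIsoPhi q H P g =
  (∀ n m → n ≡ m [mod P ] → SameCoset q H (g ^ n) (g ^ m)) ×
  (∀ n m → SameCoset q H (g ^ (n + m)) (g ^ n * g ^ m)) ×
  (∀ n m → SameCoset q H (g ^ n) (g ^ m) → n ≡ m [mod P ]) ×
  (∀ x → InG q x → Σ ℕ λ n → SameCoset q H (g ^ n) x)

{-# OPTIONS --safe #-}
module Submission where

-- (ℤ/qℤ)* is cyclic: if g has maximal order e, every order divides e (otherwise a prime power
-- could be traded in to get a larger order), so every unit is a root of x^e - 1, and Lagrange's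
-- bound on the number of roots modulo a prime forces e = q - 1.  For a primitive root g, the
-- exponents n with g^n ∈ H form the multiples of some d, and counting H gives d = P; hence
-- n ↦ g^n H is an isomorphism ℤ/P → G/H for every primitive root g.
-- To make g^(p^(r-1)) land in aH, write a = g₀^k and q - 1 = N p^α with p ∤ N.  Comparing
-- the orders of g₀ and a shows v_p(k) = α - β = r - 1, say k = u p^(r-1) with p ∤ u.  Then
-- j = N N′ u + p^α with N N′ ≡ 1 (mod p) is prime to q - 1 and j ≡ u (mod p), so g = g₀^j
-- is a primitive root with g^(p^(r-1)) ≡ a · (P-th power) and P-th powers lie in H.

open import Defs
open import Data.Nat.Base
open import Data.Nat.Properties
open import Data.Nat.Divisibility
open import Data.Nat.DivMod
open import Data.Nat.Primality
open import Data.Nat.Primality.Factorisation using (PrimeFactorisation; factorise; module PrimeFactorisation)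
open import Data.Nat.Coprimality using (Coprime; coprime-divisor) renaming (sym to coprime-sym)
open import Data.Nat.Induction using (<-wellFounded)
open import Data.Nat.ListAction using (product)
open import Data.Nat.Tactic.RingSolver using (solve-∀)
import Data.Integer.Base as ℤ
import Data.Integer.Properties as ℤ
open import Data.Fin.Base using (Fin; zero; suc; toℕ; fromℕ<)
open import Data.Fin.Properties using (pigeonhole; toℕ-fromℕ<; toℕ<n)
open import Data.List.Base using (List; []; _∷_; _++_; length; applyUpTo)
open import Data.List.Properties using (length-++; length-applyUpTo)
open import Data.List.Membership.Propositional using (_∈_)
open import Data.List.Membership.Propositional.Properties
  using (∈-∃++; ∈-++⁻; ∈-++⁺ˡ; ∈-++⁺ʳ; ∈-applyUpTo⁺; ∈-applyUpTo⁻)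
open import Data.List.Membership.DecPropositional _≟_ using (_∈?_)
open import Data.List.Relation.Unary.All as All using (All; _∷_)
open import Data.List.Relation.Unary.AllPairs using (_∷_)
open import Data.List.Relation.Unary.Any using (here; there)
open import Data.List.Relation.Unary.Unique.Propositional using (Unique)
open import Data.List.Relation.Unary.Unique.Propositional.Properties using (applyUpTo⁺₁)
open import Data.Product.Base using (Σ; ∃; ∃₂; _×_; _,_; proj₁; proj₂)
open import Data.Sum.Base using (inj₁; inj₂; [_,_]′)
open import Function.Base using (_∘_; case_of_)
open import Function.Bundles using (Equivalence; _⇔_)
open import Induction.WellFounded using (Acc; acc)
open import Relation.Binary.Bundles using (Setoid)
open import Relation.Binary.Definitions using (tri<; tri≈; tri>)
open import Relation.Binary.PropositionalEquality
import Relation.Binary.Construct.On as On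
import Relation.Binary.Reasoning.Setoid as SetoidReasoning
open import Relation.Nullary using (¬_; yes; no; contradiction)
open import Relation.Unary using (Decidable)

private variable a b c e g i j k m n o o′ p s t u v x y z x′ y′ α β ℓ N Q : ℕ

-- Primes, coprimality and valuations

prime⇒>1 : Prime p → 1 < p
prime⇒>1 {p} p-prime = nonTrivial⇒n>1 p {{prime⇒nonTrivial p-prime}}

prime∤1 : Prime p → p ∤ 1
prime∤1 p-prime p∣1 = <⇒≢ (prime⇒>1 p-prime) (sym (∣1⇒≡1 p∣1))

^-injective : 1 < p → p ^ a ≡ p ^ b → a ≡ b
^-injective {p} {a} {b} 1<p eq with <-cmp a b
... | tri< a<b _ _ = contradiction eq (<⇒≢ (^-monoʳ-< p 1<p a<b))
... | tri≈ _ a≡b _ = a≡b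
... | tri> _ _ b<a = contradiction (sym eq) (<⇒≢ (^-monoʳ-< p 1<p b<a))

^-∣-^ : ∀ p {a b} → a ≤ b → p ^ a ∣ p ^ b
^-∣-^ p {a} a≤b = divides (p ^ (_ ∸ a)) (trans (cong (p ^_) (sym (m+[n∸m]≡n a≤b)))
  (trans (^-distribˡ-+-* p a _) (*-comm (p ^ a) _)))

[m*n]^o≡m^o*n^o : ∀ m n o → (m * n) ^ o ≡ m ^ o * n ^ o
[m*n]^o≡m^o*n^o m n zero    = refl
[m*n]^o≡m^o*n^o m n (suc o) = trans (cong (m * n *_) ([m*n]^o≡m^o*n^o m n o)) (interchange m n (m ^ o) (n ^ o))
  where
  interchange : ∀ a b c d → a * b * (c * d) ≡ a * c * (b * d)
  interchange = solve-∀

prime∣^⇒∣ : Prime ℓ → ∀ k → ℓ ∣ p ^ k → ℓ ∣ p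
prime∣^⇒∣ ℓ-prime zero ℓ∣1 = contradiction ℓ∣1 (prime∤1 ℓ-prime)
prime∣^⇒∣ {p = p} ℓ-prime (suc k) ℓ∣p^[1+k] with euclidsLemma p (p ^ k) ℓ-prime ℓ∣p^[1+k]
... | inj₁ ℓ∣p   = ℓ∣p
... | inj₂ ℓ∣p^k = prime∣^⇒∣ ℓ-prime k ℓ∣p^k

prime-power-base-unique : Prime ℓ → Prime p → ℓ ^ (a + 1) ≡ p ^ b → ℓ ≡ p
prime-power-base-unique {ℓ} {p} {a} {b} ℓ-prime p-prime eq
  with prime⇒irreducible p-prime (prime∣^⇒∣ ℓ-prime b (subst (ℓ ∣_) eq ℓ∣ℓ^[a+1]))
  where
  ℓ∣ℓ^[a+1] : ℓ ∣ ℓ ^ (a + 1)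
  ℓ∣ℓ^[a+1] = subst (λ e → ℓ ∣ ℓ ^ e) (+-comm 1 a) (m∣m*n (ℓ ^ a))
... | inj₁ ℓ≡1 = contradiction ℓ≡1 (nonTrivial⇒≢1 {{prime⇒nonTrivial ℓ-prime}})
... | inj₂ ℓ≡p = ℓ≡p

prime-divisor : 1 < n → ∃ λ p → Prime p × p ∣ n
prime-divisor {n} 1<n = first-factor (factors f) (isFactorisation f) (factorsPrime f)
  where
  open PrimeFactorisation
  instance
    n≢0 : NonZero n
    n≢0 = >-nonZero (<-trans z<s 1<n)
  f : PrimeFactorisation n
  f = factorise n
  first-factor : ∀ ps → n ≡ product ps → All Prime ps → ∃ λ p → Prime p × p ∣ n
  first-factor []       n≡1 _             = contradiction n≡1 (≢-sym (<⇒≢ 1<n))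
  first-factor (p ∷ ps) n≡  (p-prime ∷ _) = p , p-prime , divides (product ps) (trans n≡ (*-comm p _))

prime∤⇒coprime : Prime p → p ∤ n → Coprime p n
prime∤⇒coprime p-prime p∤n (d∣p , d∣n) with prime⇒irreducible p-prime d∣p
... | inj₁ d≡1  = d≡1
... | inj₂ refl = contradiction d∣n p∤n

coprime-*ˡ : Coprime a n → Coprime b n → Coprime (a * b) n
coprime-*ˡ a⊥n b⊥n (d∣ab , d∣n) =
  b⊥n (coprime-divisor (λ (c∣d , c∣a) → a⊥n (c∣a , ∣-trans c∣d d∣n)) d∣ab , d∣n)

coprime-^ˡ : Coprime a n → ∀ k → Coprime (a ^ k) n
coprime-^ˡ a⊥n zero    (d∣1 , _) = ∣1⇒≡1 d∣1
coprime-^ˡ a⊥n (suc k) = coprime-*ˡ a⊥n (coprime-^ˡ a⊥n k)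

prime-power-coprime : Prime p → p ∤ n → ∀ k → Coprime (p ^ k) n
prime-power-coprime p-prime p∤n = coprime-^ˡ (prime∤⇒coprime p-prime p∤n)

coprime-∣⇒*∣ : Coprime m n → m ∣ k → n ∣ k → m * n ∣ k
coprime-∣⇒*∣ {m} {n} m⊥n (divides t refl) n∣tm = subst (m * n ∣_) (*-comm m t)
  (*-monoʳ-∣ m (coprime-divisor (coprime-sym m⊥n) (subst (n ∣_) (*-comm t m) n∣tm)))

p-part : Prime p → n ≢ 0 → ∃₂ λ a n′ → n ≡ n′ * p ^ a × p ∤ n′
p-part {p} {n} p-prime = go n (<-wellFounded n)
  where
  go : ∀ n → Acc _<_ n → n ≢ 0 → ∃₂ λ a n′ → n ≡ n′ * p ^ a × p ∤ n′
  go n (acc smaller) n≢0 with p ∣? n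
  ... | no p∤n = 0 , n , sym (*-identityʳ n) , p∤n
  ... | yes (divides k refl) with go k (smaller k<k*p) (n≢0 ∘ cong (_* p))
    where
    k<k*p : k < k * p
    k<k*p = m<m*n k p {{≢-nonZero (n≢0 ∘ cong (_* p))}} (prime⇒>1 p-prime)
  ...   | a , n′ , refl , p∤n′ = suc a , n′ , regroup , p∤n′
    where
    regroup : n′ * p ^ a * p ≡ n′ * (p * p ^ a)
    regroup = trans (*-assoc n′ (p ^ a) p) (cong (n′ *_) (*-comm (p ^ a) p))

∤⇒prime-power∤ : 0 < m → m ∤ e → ∃₂ λ p a → Prime p × p ^ a ∣ m × p ^ a ∤ e
∤⇒prime-power∤ {m} {e} = go m (<-wellFounded m)
  where
  go : ∀ m → Acc _<_ m → 0 < m → m ∤ e → ∃₂ λ p a → Prime p × p ^ a ∣ m × p ^ a ∤ e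
  go 1 _ _ 1∤e = contradiction (1∣ e) 1∤e
  go m@(suc (suc _)) (acc smaller) _ m∤e with prime-divisor {m} (s≤s (s≤s z≤n))
  ... | p , p-prime , p∣m with p-part p-prime (λ ())
  ...   | a , m′ , m≡ , p∤m′ with p ^ a ∣? e
  ...     | no p^a∤e = p , a , p-prime , divides m′ m≡ , p^a∤e
  ...     | yes p^a∣e with go m′ (smaller m′<m) (n≢0⇒n>0 m′≢0) m′∤e
    where
    m′≢0 : m′ ≢ 0
    m′≢0 refl = contradiction m≡ λ ()
    m′∤e : m′ ∤ e
    m′∤e m′∣e = m∤e (subst (_∣ e) (sym m≡)
      (coprime-∣⇒*∣ (coprime-sym (prime-power-coprime p-prime p∤m′ a)) m′∣e p^a∣e))
    a>0 : 0 < a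
    a>0 = n≢0⇒n>0 λ { refl → p∤m′ (subst (p ∣_) (trans m≡ (*-identityʳ m′)) p∣m) }
    m′<m : m′ < m
    m′<m = subst (m′ <_) (sym m≡)
      (m<m*n m′ (p ^ a) {{≢-nonZero m′≢0}} (^-monoʳ-< p (prime⇒>1 p-prime) a>0))
  ...       | ℓ , b , ℓ-prime , ℓ^b∣m′ , ℓ^b∤e =
    ℓ , b , ℓ-prime , ∣-trans ℓ^b∣m′ (divides (p ^ a) (trans m≡ (*-comm m′ (p ^ a)))) , ℓ^b∤e

IsVal⇒cofactor : ∀ {p n e} → IsVal p n e → ∃ λ n′ → n ≡ n′ * p ^ e × p ∤ n′
IsVal⇒cofactor {p} {e = e} (divides n′ n≡ , p^[1+e]∤n) =
  n′ , n≡ , λ p∣n′ → p^[1+e]∤n (subst (p * p ^ e ∣_) (sym n≡) (*-monoˡ-∣ (p ^ e) p∣n′))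

IsVal-∣⇒≤ : o ∣ n → IsVal p n α → IsVal p o β → β ≤ α
IsVal-∣⇒≤ {p = p} o∣n (_ , p^[1+α]∤n) (p^β∣o , _) =
  ≮⇒≥ λ α<β → p^[1+α]∤n (∣-trans (^-∣-^ p α<β) (∣-trans p^β∣o o∣n))

-- The last two hypotheses say that o is the order of x^k when x has order Q.
exponent-valuation : Prime p → IsVal p Q (s + suc β) → IsVal p o (suc β) →
                     Q ∣ k * o → (∀ {n} → Q ∣ k * n → o ∣ n) → IsVal p k s
exponent-valuation {p} {Q} {s} {β} {o} {k} p-prime Q-val o-val Q∣ko o-min
  with N , refl , p∤N ← IsVal⇒cofactor {p} {e = s + suc β} Q-val
     | O , refl , p∤O ← IsVal⇒cofactor {p} {e = suc β} o-val =
  A∣k , pA∤k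
  where
  A B : ℕ
  A = p ^ s
  B = p ^ β
  instance
    p≢0 : NonZero p
    p≢0 = prime⇒nonZero p-prime
    B≢0 : NonZero B
    B≢0 = m^n≢0 p β
    pB≢0 : NonZero (p * B)
    pB≢0 = m*n≢0 p B
    p^α≢0 : NonZero (p ^ (s + suc β))
    p^α≢0 = m^n≢0 p (s + suc β)
  p^α≡ : p ^ (s + suc β) ≡ A * (p * B)
  p^α≡ = ^-distribˡ-+-* p s (suc β)
  A∣k : A ∣ k
  A∣k = coprime-divisor (prime-power-coprime p-prime p∤O s) (subst (A ∣_) (*-comm k O)
    (*-cancelʳ-∣ (p * B)
      (subst₂ _∣_ p^α≡ (sym (*-assoc k O (p * B))) (∣-trans (n∣m*n N) Q∣ko))))
  -- If p ^ (s + 1) ∣ k, then Q already divides k * (o / p), contradicting the minimality of o.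
  pA∤k : p * A ∤ k
  pA∤k (divides w k≡) = <⇒≱ n<o (∣⇒≤ {{m*n≢0 O B {{≢-nonZero O≢0}}}} (o-min Q∣kn))
    where
    O≢0 : O ≢ 0
    O≢0 refl = p∤O (p ∣0)
    n<o : O * B < O * (p * B)
    n<o = *-monoʳ-< O {{≢-nonZero O≢0}} (subst (B <_) (*-comm B p) (m<m*n B p (prime⇒>1 p-prime)))
    rearrange₁ : ∀ w O p A B → w * (p * A) * (O * (p * B)) ≡ w * O * p * (A * (p * B))
    rearrange₁ = solve-∀
    rearrange₂ : ∀ w O p A B → w * (p * A) * (O * B) ≡ w * O * (A * (p * B))
    rearrange₂ = solve-∀
    N∣wOp : N ∣ w * O * p
    N∣wOp = *-cancelʳ-∣ (p ^ (s + suc β)) (subst (N * p ^ (s + suc β) ∣_)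
      (trans (cong (_* (O * (p * B))) k≡) (trans (rearrange₁ w O p A B) (cong (w * O * p *_) (sym p^α≡)))) Q∣ko)
    N∣wO : N ∣ w * O
    N∣wO = coprime-divisor (coprime-sym (prime∤⇒coprime p-prime p∤N)) (subst (N ∣_) (*-comm (w * O) p) N∣wOp)
    Q∣kn : N * p ^ (s + suc β) ∣ k * (O * B)
    Q∣kn = subst (N * p ^ (s + suc β) ∣_)
      (sym (trans (cong (_* (O * B)) k≡) (trans (rearrange₂ w O p A B) (cong (w * O *_) (sym p^α≡)))))
      (*-monoˡ-∣ (p ^ (s + suc β)) N∣wO)

-- Sets of multiples

least : (P : ℕ → Set) → Decidable P → P n → ∃ λ m → P m × (∀ {k} → k < m → ¬ P k)
least {zero}  P P? P0 = 0 , P0 , λ ()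
least {suc n} P P? Pn with P? 0
... | yes P0 = 0 , P0 , λ ()
... | no ¬P0 with least (P ∘ suc) (P? ∘ suc) Pn
...   | m , P[1+m] , below = suc m , P[1+m] , λ { {zero} _ → ¬P0 ; {suc k} k<m → below (s≤s⁻¹ k<m) }

below-suc : {P : ℕ → Set} → (∀ {x} → x < k → P x) → P k → ∀ {x} → x < suc k → P x
below-suc below at-k x<1+k with m<1+n⇒m<n∨m≡n x<1+k
... | inj₁ x<k  = below x<k
... | inj₂ refl = at-k

record IsMultiplesOf (S : ℕ → Set) (d : ℕ) : Set where
  field
    positive : 0 < d
    ∈⇒∣      : ∀ {n} → S n → d ∣ n
    ∣⇒∈      : ∀ {n} → d ∣ n → S n

open IsMultiplesOf public

+-∸-closed⇒multiples : {S : ℕ → Set} → Decidable S →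
  (∀ a b → S a → S b → S (a + b)) → (∀ a b → S a → S (a + b) → S b) →
  0 < n → S n → ∃ (IsMultiplesOf S)
+-∸-closed⇒multiples {suc n} {S} S? S-+ S-∸ _ S[1+n] with least (S ∘ suc) (S? ∘ suc) S[1+n]
... | m , S[1+m] , below = d , record { positive = z<s ; ∈⇒∣ = ∈⇒∣′ ; ∣⇒∈ = ∣⇒∈′ }
  where
  d : ℕ
  d = suc m
  multiple : ∀ t → S (t * d)
  multiple zero    = S-∸ d 0 S[1+m] (subst S (sym (+-identityʳ d)) S[1+m])
  multiple (suc t) = S-+ d (t * d) S[1+m] (multiple t)
  ∣⇒∈′ : d ∣ k → S k
  ∣⇒∈′ (divides t refl) = multiple t
  ∈⇒∣′ : S k → d ∣ k
  ∈⇒∣′ {k} Sk with k % d in k%d≡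
  ... | zero  = m%n≡0⇒n∣m k d k%d≡
  ... | suc r = contradiction (subst S k%d≡ S[k%d]) (below (s≤s⁻¹ (subst (_< d) k%d≡ (m%n<n k d))))
    where
    S[k%d] : S (k % d)
    S[k%d] = S-∸ (k / d * d) (k % d) (multiple (k / d)) (subst S (trans (m≡m%n+[m/n]*n k d) (+-comm (k % d) _)) Sk)

-- Functions with natural coefficients in Horner form, of the given degree and leading coefficient.
Polynomial : (degree leading : ℕ) → (ℕ → ℕ) → Set
Polynomial zero    ℓ f = ∀ x → f x ≡ ℓ
Polynomial (suc n) ℓ f = ∃₂ λ c g → Polynomial n ℓ g × (∀ x → f x ≡ c + x * g x)

polynomial-scale : ∀ n r {ℓ f} → Polynomial n ℓ f → Polynomial n (r * ℓ) (λ x → r * f x)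
polynomial-scale zero    r f≡ x = cong (r *_) (f≡ x)
polynomial-scale (suc n) r (c , g , g-poly , f≡) =
  r * c , (λ x → r * g x) , polynomial-scale n r g-poly , λ x → trans (cong (r *_) (f≡ x)) (distrib r c x (g x))
  where
  distrib : ∀ r c x y → r * (c + x * y) ≡ r * c + x * (r * y)
  distrib = solve-∀

polynomial-+-lower : ∀ n {ℓ ℓ′ f g} → Polynomial (suc n) ℓ f → Polynomial n ℓ′ g →
                     Polynomial (suc n) ℓ (λ x → f x + g x)
polynomial-+-lower zero {ℓ′ = ℓ′} (c , f′ , f′-poly , f≡) g≡ =
  c + ℓ′ , f′ , f′-poly , λ x → trans (cong₂ _+_ (f≡ x) (g≡ x)) (regroup c x (f′ x) ℓ′)
  where
  regroup : ∀ c x y d → c + x * y + d ≡ c + d + x * y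
  regroup = solve-∀
polynomial-+-lower (suc n) (c , f′ , f′-poly , f≡) (d , g′ , g′-poly , g≡) =
  c + d , (λ x → f′ x + g′ x) , polynomial-+-lower n f′-poly g′-poly ,
  λ x → trans (cong₂ _+_ (f≡ x) (g≡ x)) (regroup c x (f′ x) d (g′ x))
  where
  regroup : ∀ c x y d z → c + x * y + (d + x * z) ≡ c + d + x * (y + z)
  regroup = solve-∀

-- f x - f r = (x - r) * g x, with both sides moved so that no subtraction occurs.
factor-theorem : ∀ n {ℓ f} → Polynomial (suc n) ℓ f → ∀ r →
                 ∃ λ g → Polynomial n ℓ g × (∀ x → f x + r * g x ≡ f r + x * g x)
factor-theorem zero {ℓ} {f} (c , h , h≡ , f≡) r = h , h≡ , λ x → begin
  f x + r * h x            ≡⟨ cong₂ (λ u v → u + r * v) (f≡ x) (h≡ x) ⟩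
  c + x * h x + r * ℓ      ≡⟨ cong (λ u → c + x * u + r * ℓ) (h≡ x) ⟩
  c + x * ℓ + r * ℓ        ≡⟨ regroup c x r ℓ ⟩
  c + r * ℓ + x * ℓ        ≡⟨ cong₂ (λ u v → c + r * u + x * v) (h≡ r) (h≡ x) ⟨
  c + r * h r + x * h x    ≡⟨ cong (_+ x * h x) (f≡ r) ⟨
  f r + x * h x            ∎
  where
  open ≡-Reasoning
  regroup : ∀ c x r ℓ → c + x * ℓ + r * ℓ ≡ c + r * ℓ + x * ℓ
  regroup = solve-∀
factor-theorem (suc n) {f = f} (c , h , h-poly , f≡) r with factor-theorem n h-poly r
... | d , d-poly , h-step = (λ x → h x + r * d x) ,
  polynomial-+-lower n h-poly (polynomial-scale n r d-poly) , λ x → begin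
    f x + r * (h x + r * d x)                ≡⟨ cong₂ (λ u v → u + r * v) (f≡ x) (h-step x) ⟩
    c + x * h x + r * (h r + x * d x)        ≡⟨ regroup c x (h x) r (h r) (d x) ⟩
    c + r * h r + x * (h x + r * d x)        ≡⟨ cong (_+ x * (h x + r * d x)) (f≡ r) ⟨
    f r + x * (h x + r * d x)                ∎
  where
  open ≡-Reasoning
  regroup : ∀ c x hx r hr dx → c + x * hx + r * (hr + x * dx) ≡ c + r * hr + x * (hx + r * dx)
  regroup = solve-∀

power-polynomial : ∀ e → Polynomial e 1 (_^ e)
power-polynomial zero    x = refl
power-polynomial (suc e) = 0 , (_^ e) , power-polynomial e , λ x → refl

unique-⊆⇒length≤ : {A : Set} {xs ys : List A} → Unique xs → (∀ {z} → z ∈ xs → z ∈ ys) → length xs ≤ length ys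
unique-⊆⇒length≤ {xs = []} _ _ = z≤n
unique-⊆⇒length≤ {xs = x ∷ xs} {ys} (x∉xs ∷ xs!) xxs⊆ys with ∈-∃++ (xxs⊆ys (here refl))
... | us , vs , refl = subst (suc (length xs) ≤_) (sym length≡) (s≤s (unique-⊆⇒length≤ xs! xs⊆us++vs))
  where
  length≡ : length (us ++ x ∷ vs) ≡ suc (length (us ++ vs))
  length≡ = trans (length-++ us) (trans (+-suc (length us) (length vs)) (cong suc (sym (length-++ us))))
  xs⊆us++vs : ∀ {z} → z ∈ xs → z ∈ us ++ vs
  xs⊆us++vs z∈xs with ∈-++⁻ us (xxs⊆ys (there z∈xs))
  ... | inj₁ z∈us         = ∈-++⁺ˡ z∈us
  ... | inj₂ (here refl)  = contradiction refl (All.lookup x∉xs z∈xs)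
  ... | inj₂ (there z∈vs) = ∈-++⁺ʳ us z∈vs

-- Congruences

∣+m-+n∣≡∣m-n∣ : ∀ m n → ℤ.∣ ℤ.+ m ℤ.- ℤ.+ n ∣ ≡ ∣ m - n ∣
∣+m-+n∣≡∣m-n∣ m n with ≤-total m n
... | inj₁ m≤n = trans (cong ℤ.∣_∣ (ℤ.[+m]-[+n]≡m⊖n m n))
  (trans (ℤ.∣⊖∣-≤ m≤n) (sym (m≤n⇒∣m-n∣≡n∸m m≤n)))
... | inj₂ n≤m = trans (cong ℤ.∣_∣ (ℤ.[+m]-[+n]≡m⊖n m n))
  (trans (ℤ.∣m⊖n∣≡∣n⊖m∣ m n) (trans (ℤ.∣⊖∣-≤ n≤m) (sym (m≤n⇒∣n-m∣≡n∸m n≤m))))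

module Congruence (n : ℕ) .{{_ : NonZero n}} where

  infix 4 _≈_
  _≈_ : ℕ → ℕ → Set
  x ≈ y = x % n ≡ y % n

  ≈-setoid : Setoid _ _
  ≈-setoid = On.setoid (setoid ℕ) (_% n)

  module ≈-Reasoning = SetoidReasoning ≈-setoid

  %-≈ : ∀ x → x % n ≈ x
  %-≈ x = m%n%n≡m%n x n

  ≈-+ : x ≈ x′ → y ≈ y′ → x + y ≈ x′ + y′
  ≈-+ {x} {x′} {y} {y′} x≈ y≈ = begin
    (x + y) % n            ≡⟨ %-distribˡ-+ x y n ⟩
    (x % n + y % n) % n    ≡⟨ cong₂ (λ u v → (u + v) % n) x≈ y≈ ⟩
    (x′ % n + y′ % n) % n  ≡⟨ %-distribˡ-+ x′ y′ n ⟨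
    (x′ + y′) % n          ∎
    where open ≡-Reasoning

  ≈-* : x ≈ x′ → y ≈ y′ → x * y ≈ x′ * y′
  ≈-* {x} {x′} {y} {y′} x≈ y≈ = begin
    (x * y) % n             ≡⟨ %-distribˡ-* x y n ⟩
    (x % n * (y % n)) % n   ≡⟨ cong₂ (λ u v → (u * v) % n) x≈ y≈ ⟩
    (x′ % n * (y′ % n)) % n ≡⟨ %-distribˡ-* x′ y′ n ⟨
    (x′ * y′) % n           ∎
    where open ≡-Reasoning

  ≈-^ : x ≈ y → ∀ k → x ^ k ≈ y ^ k
  ≈-^ x≈y zero    = refl
  ≈-^ x≈y (suc k) = ≈-* x≈y (≈-^ x≈y k)

  ≈⇒∣∣-∣ : x ≈ y → n ∣ ∣ x - y ∣
  ≈⇒∣∣-∣ {x} {y} x≈y = divides ∣ x / n - y / n ∣ (begin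
    ∣ x - y ∣                                  ≡⟨ cong₂ ∣_-_∣ (m≡m%n+[m/n]*n x n) (m≡m%n+[m/n]*n y n) ⟩
    ∣ x % n + x / n * n - y % n + y / n * n ∣  ≡⟨ cong (λ r → ∣ x % n + x / n * n - r + y / n * n ∣) x≈y ⟨
    ∣ x % n + x / n * n - x % n + y / n * n ∣  ≡⟨ ∣m+n-m+o∣≡∣n-o∣ (x % n) (x / n * n) (y / n * n) ⟩
    ∣ x / n * n - y / n * n ∣                  ≡⟨ *-distribʳ-∣-∣ n (x / n) (y / n) ⟨
    ∣ x / n - y / n ∣ * n                      ∎)
    where open ≡-Reasoning

  ∣∣-∣⇒≈ : n ∣ ∣ x - y ∣ → x ≈ y
  ∣∣-∣⇒≈ {x} {y} n∣ with ≤-total x y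
  ... | inj₁ x≤y = sym (trans (cong (_% n) (sym (m+[n∸m]≡n x≤y)))
                              (%-remove-+ʳ x (subst (n ∣_) (m≤n⇒∣m-n∣≡n∸m x≤y) n∣)))
  ... | inj₂ y≤x = trans (cong (_% n) (sym (m+[n∸m]≡n y≤x)))
                         (%-remove-+ʳ y (subst (n ∣_) (m≤n⇒∣n-m∣≡n∸m y≤x) n∣))

  ≈⇒≡[mod] : x ≈ y → x ≡ y [mod n ]
  ≈⇒≡[mod] {x} {y} x≈y = subst (n ∣_) (sym (∣+m-+n∣≡∣m-n∣ x y)) (≈⇒∣∣-∣ x≈y)

  ≡[mod]⇒≈ : x ≡ y [mod n ] → x ≈ y
  ≡[mod]⇒≈ {x} {y} x≡y = ∣∣-∣⇒≈ (subst (n ∣_) (∣+m-+n∣≡∣m-n∣ x y) x≡y)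

  +-cancelˡ-≈ : ∀ a → a + x ≈ a + y → x ≈ y
  +-cancelˡ-≈ {x} {y} a a+x≈a+y = ∣∣-∣⇒≈ (subst (n ∣_) (∣m+n-m+o∣≡∣n-o∣ a x y) (≈⇒∣∣-∣ a+x≈a+y))

  ∣⇒≈0 : n ∣ x → x ≈ 0
  ∣⇒≈0 {x} n∣x = trans (n∣m⇒m%n≡0 x n n∣x) (sym (m<n⇒m%n≡m (>-nonZero⁻¹ n)))

  ≈0⇒∣ : x ≈ 0 → n ∣ x
  ≈0⇒∣ {x} x≈0 = m%n≡0⇒n∣m x n (trans x≈0 (m<n⇒m%n≡m (>-nonZero⁻¹ n)))

-- Arithmetic modulo a prime

module PrimeModulus {q : ℕ} (q-prime : Prime q) where

  instance
    q≢0 : NonZero q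
    q≢0 = prime⇒nonZero q-prime

  open Congruence q public

  ∤-* : q ∤ x → q ∤ y → q ∤ x * y
  ∤-* q∤x q∤y q∣xy = [ q∤x , q∤y ]′ (euclidsLemma _ _ q-prime q∣xy)

  ∤-^ : q ∤ x → ∀ k → q ∤ x ^ k
  ∤-^ q∤x zero    = prime∤1 q-prime
  ∤-^ q∤x (suc k) = ∤-* q∤x (∤-^ q∤x k)

  InG⇒∤ : InG q x → q ∤ x
  InG⇒∤ (1≤x , x<q) q∣x = <⇒≱ x<q (∣⇒≤ {{>-nonZero 1≤x}} q∣x)

  ∤⇒InG-% : q ∤ x → InG q (x % q)
  ∤⇒InG-% {x} q∤x = n≢0⇒n>0 (q∤x ∘ m%n≡0⇒n∣m x q) , m%n<n x q

  ≈⇒≡-below : x < q → y < q → x ≈ y → x ≡ y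
  ≈⇒≡-below x<q y<q x≈y = trans (sym (m<n⇒m%n≡m x<q)) (trans x≈y (m<n⇒m%n≡m y<q))

  *-cancelˡ-≈ : q ∤ x → x * y ≈ x * z → y ≈ z
  *-cancelˡ-≈ {x} {y} {z} q∤x xy≈xz
    with euclidsLemma x ∣ y - z ∣ q-prime (subst (q ∣_) (sym (*-distribˡ-∣-∣ x y z)) (≈⇒∣∣-∣ xy≈xz))
  ... | inj₁ q∣x     = contradiction q∣x q∤x
  ... | inj₂ q∣∣y-z∣ = ∣∣-∣⇒≈ q∣∣y-z∣

  ^-cancel : q ∤ x → i ≤ j → x ^ i ≈ x ^ j → x ^ (j ∸ i) ≈ 1
  ^-cancel {x} {i} {j} q∤x i≤j x^i≈x^j = sym (*-cancelˡ-≈ (∤-^ q∤x i) (begin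
    x ^ i * 1              ≡⟨ *-identityʳ (x ^ i) ⟩
    x ^ i                  ≈⟨ x^i≈x^j ⟩
    x ^ j                  ≡⟨ cong (x ^_) (m+[n∸m]≡n i≤j) ⟨
    x ^ (i + (j ∸ i))      ≡⟨ ^-distribˡ-+-* x i (j ∸ i) ⟩
    x ^ i * x ^ (j ∸ i)    ∎))
    where open ≈-Reasoning

  -- The existence proofs below search exhaustively (pigeonhole, maxima over all residues);
  -- they are opaque so that the type checker never tries to evaluate them.
  opaque
    units-pigeonhole : (v : ℕ → ℕ) → (∀ i → q ∤ v i) → ∃₂ λ i j → i < j × j < q × v i ≈ v j
    units-pigeonhole v q∤v with pigeonhole (n<1+n q) residue
      where
      residue : Fin (suc q) → Fin q
      residue zero    = fromℕ< (>-nonZero⁻¹ q)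
      residue (suc i) = fromℕ< (m%n<n (v (toℕ i)) q)
    ... | zero  , suc j , _ , 0≡ = contradiction (m%n≡0⇒n∣m _ q (sym
            (trans (sym (toℕ-fromℕ< (>-nonZero⁻¹ q))) (trans (cong toℕ 0≡) (toℕ-fromℕ< _))))) (q∤v (toℕ j))
    ... | suc i , suc j , s<s i<j , eq = toℕ i , toℕ j , i<j , toℕ<n j ,
            trans (sym (toℕ-fromℕ< _)) (trans (cong toℕ eq) (toℕ-fromℕ< _))

  HasOrder : ℕ → ℕ → Set
  HasOrder x = IsMultiplesOf (λ n → x ^ n ≈ 1)

  pow-order : HasOrder x o → x ^ o ≈ 1
  pow-order x-ord = ∣⇒∈ x-ord ∣-refl

  order-from-root : 0 < n → x ^ n ≈ 1 → ∃ (HasOrder x)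
  order-from-root {n} {x} = +-∸-closed⇒multiples {n} (λ n → x ^ n % q ≟ 1 % q) closed-+ closed-∸
    where
    open ≈-Reasoning
    closed-+ : ∀ a b → x ^ a ≈ 1 → x ^ b ≈ 1 → x ^ (a + b) ≈ 1
    closed-+ a b x^a≈1 x^b≈1 = begin
      x ^ (a + b)    ≡⟨ ^-distribˡ-+-* x a b ⟩
      x ^ a * x ^ b  ≈⟨ ≈-* x^a≈1 x^b≈1 ⟩
      1              ∎
    closed-∸ : ∀ a b → x ^ a ≈ 1 → x ^ (a + b) ≈ 1 → x ^ b ≈ 1
    closed-∸ a b x^a≈1 x^[a+b]≈1 = begin
      x ^ b          ≡⟨ *-identityˡ (x ^ b) ⟨
      1 * x ^ b      ≈⟨ ≈-* (sym x^a≈1) refl ⟩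
      x ^ a * x ^ b  ≡⟨ ^-distribˡ-+-* x a b ⟨
      x ^ (a + b)    ≈⟨ x^[a+b]≈1 ⟩
      1              ∎

  opaque
    order-exists : q ∤ x → ∃ λ o → HasOrder x o × o < q
    order-exists {x} q∤x with units-pigeonhole (x ^_) (∤-^ q∤x)
    ... | i , j , i<j , j<q , x^i≈x^j with ^-cancel q∤x (<⇒≤ i<j) x^i≈x^j
    ...   | root with order-from-root (m<n⇒0<n∸m i<j) root
    ...     | o , x-ord = o , x-ord ,
      ≤-<-trans (∣⇒≤ {{>-nonZero (m<n⇒0<n∸m i<j)}} (∈⇒∣ x-ord root)) (≤-<-trans (m∸n≤m j i) j<q)

  IsOrd⇒HasOrder : IsOrd q x o → HasOrder x o
  IsOrd⇒HasOrder {x} {o} (o>0 , x^o≡1 , below) with order-from-root o>0 (≡[mod]⇒≈ x^o≡1)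
  ... | d , x-ord = subst (HasOrder x) d≡o x-ord
    where
    d≡o : d ≡ o
    d≡o = ≤-antisym (∣⇒≤ {{>-nonZero o>0}} (∈⇒∣ x-ord (≡[mod]⇒≈ x^o≡1)))
                    (≮⇒≥ λ d<o → below d (positive x-ord) d<o (≈⇒≡[mod] (pow-order x-ord)))

  order-unique : HasOrder x o → HasOrder x o′ → o ≡ o′
  order-unique x-ord x-ord′ = ∣-antisym (∈⇒∣ x-ord (pow-order x-ord′)) (∈⇒∣ x-ord′ (pow-order x-ord))

  order-resp-≈ : x ≈ y → HasOrder x o → HasOrder y o
  order-resp-≈ x≈y x-ord = record
    { positive = positive x-ord
    ; ∈⇒∣      = λ {n} y^n≈1 → ∈⇒∣ x-ord (trans (≈-^ x≈y n) y^n≈1)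
    ; ∣⇒∈      = λ {n} o∣n → trans (sym (≈-^ x≈y n)) (∣⇒∈ x-ord o∣n)
    }

  order⇒∤ : HasOrder x o → q ∤ x
  order⇒∤ {x} {o} x-ord q∣x with o | positive x-ord | pow-order x-ord
  ... | suc o′ | _ | x^o≈1 = prime∤1 q-prime (≈0⇒∣ (trans (sym x^o≈1) (≈-^ (∣⇒≈0 q∣x) (suc o′))))

  order-of-one : HasOrder 1 1
  order-of-one = record { positive = z<s ; ∈⇒∣ = λ {n} _ → 1∣ n ; ∣⇒∈ = λ {n} _ → cong (_% q) (^-zeroˡ n) }

  order-of-power : ∀ k → HasOrder x (k * o) → HasOrder (x ^ k) o
  order-of-power {x} {o} k x-ord = record
    { positive = n≢0⇒n>0 λ { refl → <⇒≢ (positive x-ord) (sym (*-zeroʳ k)) }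
    ; ∈⇒∣      = λ {n} x^kn≈1 → *-cancelˡ-∣ k {{k≢0}} (∈⇒∣ x-ord (subst (_≈ 1) (^-*-assoc x k n) x^kn≈1))
    ; ∣⇒∈      = λ {n} o∣n → subst (_≈ 1) (sym (^-*-assoc x k n)) (∣⇒∈ x-ord (*-monoʳ-∣ k o∣n))
    }
    where
    k≢0 : NonZero k
    k≢0 = m*n≢0⇒m≢0 k {{>-nonZero (positive x-ord)}}

  order-of-coprime-power : HasOrder x o → Coprime o c → HasOrder (x ^ c) o
  order-of-coprime-power {x} {o} {c} x-ord o⊥c = record
    { positive = positive x-ord
    ; ∈⇒∣      = λ {n} x^cn≈1 → coprime-divisor o⊥c (∈⇒∣ x-ord (subst (_≈ 1) (^-*-assoc x c n) x^cn≈1))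
    ; ∣⇒∈      = λ {n} o∣n → subst (_≈ 1) (sym (^-*-assoc x c n)) (∣⇒∈ x-ord (∣n⇒∣m*n c o∣n))
    }

  order-∣-of-product : HasOrder u s → HasOrder v t → Coprime s t → (u * v) ^ n ≈ 1 → s ∣ n
  order-∣-of-product {u} {s} {v} {t} {n} u-ord v-ord s⊥t [uv]^n≈1 =
    coprime-divisor s⊥t (∈⇒∣ u-ord (begin
      u ^ (t * n)                  ≡⟨ *-identityʳ _ ⟨
      u ^ (t * n) * 1              ≈⟨ ≈-* {u ^ (t * n)} refl (∣⇒∈ v-ord (∣m⇒∣m*n n ∣-refl)) ⟨
      u ^ (t * n) * v ^ (t * n)    ≡⟨ [m*n]^o≡m^o*n^o u v (t * n) ⟨
      (u * v) ^ (t * n)            ≡⟨ cong ((u * v) ^_) (*-comm t n) ⟩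
      (u * v) ^ (n * t)            ≡⟨ ^-*-assoc (u * v) n t ⟨
      ((u * v) ^ n) ^ t            ≈⟨ ≈-^ [uv]^n≈1 t ⟩
      1 ^ t                        ≡⟨ ^-zeroˡ t ⟩
      1                            ∎))
    where open ≈-Reasoning

  order-of-product : HasOrder u s → HasOrder v t → Coprime s t → HasOrder (u * v) (s * t)
  order-of-product {u} {s} {v} {t} u-ord v-ord s⊥t = record
    { positive = *-mono-< (positive u-ord) (positive v-ord)
    ; ∈⇒∣      = λ {n} [uv]^n≈1 → coprime-∣⇒*∣ s⊥t (order-∣-of-product u-ord v-ord s⊥t [uv]^n≈1)
                   (order-∣-of-product v-ord u-ord (coprime-sym s⊥t) (subst (λ w → w ^ n ≈ 1) (*-comm u v) [uv]^n≈1))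
    ; ∣⇒∈      = λ {n} st∣n → begin
        (u * v) ^ n      ≡⟨ [m*n]^o≡m^o*n^o u v n ⟩
        u ^ n * v ^ n    ≈⟨ ≈-* (∣⇒∈ u-ord (∣-trans (m∣m*n t) st∣n))
                                (∣⇒∈ v-ord (∣-trans (n∣m*n s) st∣n)) ⟩
        1                ∎
    }
    where open ≈-Reasoning

  order-of-mixed-power : Prime p → p ∤ N → p ∤ c → HasOrder g (N * p ^ α) →
                         HasOrder (g ^ (N * c + p ^ α)) (N * p ^ α)
  order-of-mixed-power {p} {N} {c} {g} {α} p-prime p∤N p∤c g-ord =
    subst₂ HasOrder (sym (trans (^-distribˡ-+-* g (N * c) (p ^ α)) (cong (_* g ^ p ^ α) (sym (^-*-assoc g N c)))))
                    (*-comm (p ^ α) N)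
      (order-of-product
        (order-of-coprime-power (order-of-power N g-ord) (prime-power-coprime p-prime p∤c α))
        (order-of-power (p ^ α) (subst (HasOrder g) (*-comm N (p ^ α)) g-ord))
        (prime-power-coprime p-prime p∤N α))

  power-order-∣ : ∀ k → HasOrder g Q → HasOrder (g ^ k) o → Q ∣ k * n → o ∣ n
  power-order-∣ {g} {n = n} k g-ord gk-ord Q∣kn =
    ∈⇒∣ gk-ord (subst (_≈ 1) (sym (^-*-assoc g k n)) (∣⇒∈ g-ord Q∣kn))

  ∣-power-order : ∀ k → HasOrder g Q → HasOrder (g ^ k) o → Q ∣ k * o
  ∣-power-order {g} {o = o} k g-ord gk-ord = ∈⇒∣ g-ord (subst (_≈ 1) (^-*-assoc g k o) (pow-order gk-ord))

  pow-≈⇒order-∣ : HasOrder x o → x ^ i ≈ x ^ j → o ∣ ∣ i - j ∣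
  pow-≈⇒order-∣ {x} {o} {i} {j} x-ord x^i≈x^j with ≤-total i j
  ... | inj₁ i≤j = subst (o ∣_) (sym (m≤n⇒∣m-n∣≡n∸m i≤j))
                     (∈⇒∣ x-ord (^-cancel (order⇒∤ x-ord) i≤j x^i≈x^j))
  ... | inj₂ j≤i = subst (o ∣_) (sym (m≤n⇒∣n-m∣≡n∸m j≤i))
                     (∈⇒∣ x-ord (^-cancel (order⇒∤ x-ord) j≤i (sym x^i≈x^j)))

  pow-distinct : HasOrder x o → i < j → j < o → ¬ x ^ i ≈ x ^ j
  pow-distinct {x} {o} {i} {j} x-ord i<j j<o x^i≈x^j = <⇒≱ (≤-<-trans (m∸n≤m j i) j<o)
    (∣⇒≤ {{>-nonZero (m<n⇒0<n∸m i<j)}} (∈⇒∣ x-ord (^-cancel (order⇒∤ x-ord) (<⇒≤ i<j) x^i≈x^j)))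

  opaque
    ∤⇒inverse : q ∤ n → ∃₂ λ n′ t → n * n′ ≡ 1 + t * q
    ∤⇒inverse {n} q∤n with order-exists q∤n
    ... | o , n-ord , _ = n ^ (o ∸ 1) , n ^ o / q , (begin
      n * n ^ (o ∸ 1)             ≡⟨ cong (n ^_) (m+[n∸m]≡n (positive n-ord)) ⟩
      n ^ o                       ≡⟨ m≡m%n+[m/n]*n (n ^ o) q ⟩
      n ^ o % q + n ^ o / q * q   ≡⟨ cong (_+ n ^ o / q * q) (trans (pow-order n-ord) (m<n⇒m%n≡m (prime⇒>1 q-prime))) ⟩
      1 + n ^ o / q * q           ∎)
      where open ≡-Reasoning

  peel-root : ∀ {n k f c} → Polynomial (suc n) 1 f → suc k < q → (∀ {x} → 1 ≤ x → x ≤ suc k → f x ≈ c) →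
              ∃ λ g → Polynomial n 1 g × (∀ {x} → 1 ≤ x → x ≤ k → g x ≈ 0)
  peel-root {n} {k} {f} f-poly k<q roots with factor-theorem n f-poly (suc k)
  ... | g , g-poly , f≡ = g , g-poly , g-root
    where
    r : ℕ
    r = suc k
    g-root : ∀ {x} → 1 ≤ x → x ≤ k → g x ≈ 0
    g-root {x} 1≤x x≤k with q ∣? g x
    ... | yes q∣gx = ∣⇒≈0 q∣gx
    ... | no  q∤gx = contradiction (≈⇒≡-below k<q (<-trans (s≤s x≤k) k<q) (*-cancelˡ-≈ q∤gx gr≈gx))
                                   (<⇒≢ (s≤s x≤k) ∘ sym)
      where
      open ≈-Reasoning
      gr≈gx : g x * r ≈ g x * x
      gr≈gx = +-cancelˡ-≈ (f r) (begin
        f r + g x * r    ≡⟨ cong (f r +_) (*-comm (g x) r) ⟩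
        f r + r * g x    ≈⟨ ≈-+ (trans (roots (s≤s z≤n) ≤-refl) (sym (roots 1≤x (m≤n⇒m≤1+n x≤k)))) refl ⟩
        f x + r * g x    ≡⟨ f≡ x ⟩
        f r + x * g x    ≡⟨ cong (f r +_) (*-comm x (g x)) ⟩
        f r + g x * x    ∎)

  roots≤degree : ∀ {n k f} → Polynomial n 1 f → k < q → (∀ {x} → 1 ≤ x → x ≤ k → f x ≈ 0) → k ≤ n
  roots≤degree {k = zero} _ _ _ = z≤n
  roots≤degree {zero} {suc k} f≡1 _ roots =
    contradiction (≈0⇒∣ (subst (_≈ 0) (f≡1 1) (roots ≤-refl (s≤s z≤n)))) (prime∤1 q-prime)
  roots≤degree {suc n} {suc k} f-poly k<q roots with peel-root f-poly k<q roots
  ... | g , g-poly , g-roots = s≤s (roots≤degree g-poly (<-trans (n<1+n k) k<q) g-roots)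

  solutions≤degree : ∀ {n k f c} → Polynomial (suc n) 1 f → k < q →
                     (∀ {x} → 1 ≤ x → x ≤ k → f x ≈ c) → k ≤ suc n
  solutions≤degree {k = zero} _ _ _ = z≤n
  solutions≤degree {k = suc k} f-poly k<q sols with peel-root f-poly k<q sols
  ... | g , g-poly , g-roots = s≤s (roots≤degree g-poly (<-trans (n<1+n k) k<q) g-roots)

  roots-of-unity-bound : 0 < e → (∀ {x} → q ∤ x → x ^ e ≈ 1) → q ∸ 1 ≤ e
  roots-of-unity-bound {suc e} _ roots = solutions≤degree (power-polynomial (suc e)) q∸1<q
    (λ 1≤x x≤q∸1 → roots (InG⇒∤ (1≤x , ≤-<-trans x≤q∸1 q∸1<q)))
    where
    q∸1<q : q ∸ 1 < q
    q∸1<q = ∸-monoʳ-< z<s (>-nonZero⁻¹ q)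

  -- Otherwise some p ^ a ∣ m exceeds the p-part p ^ b of e, and x ^ (m / p ^ a) * g ^ (p ^ b)
  -- has order p ^ a * (e / p ^ b) > e.
  order-∣-max-order : HasOrder g e → (∀ {y o} → HasOrder y o → o ≤ e) → HasOrder x m → m ∣ e
  order-∣-max-order {g} {e} {x} {m} g-ord maximal x-ord with m ∣? e
  ... | yes m∣e = m∣e
  ... | no  m∤e with ∤⇒prime-power∤ (positive x-ord) m∤e
  ...   | p , a , p-prime , p^a∣m , p^a∤e with p-part p-prime (≢-nonZero⁻¹ e {{>-nonZero (positive g-ord)}})
  ...     | b , e′ , e≡ , p∤e′ = contradiction (maximal larger-order) (<⇒≱ e<p^a*e′)
    where
    instance
      p≢0 : NonZero p
      p≢0 = prime⇒nonZero p-prime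
    b<a : b < a
    b<a = ≰⇒> λ a≤b → p^a∤e (subst (p ^ a ∣_) (sym e≡) (∣n⇒∣m*n e′ (^-∣-^ p a≤b)))
    e′≢0 : NonZero e′
    e′≢0 = ≢-nonZero λ { refl → <⇒≢ (positive g-ord) (sym e≡) }
    e<p^a*e′ : e < p ^ a * e′
    e<p^a*e′ = subst (_< p ^ a * e′) (trans (*-comm (p ^ b) e′) (sym e≡))
      (*-monoˡ-< e′ {{e′≢0}} (^-monoʳ-< p (prime⇒>1 p-prime) b<a))
    larger-order : HasOrder (x ^ quotient p^a∣m * g ^ p ^ b) (p ^ a * e′)
    larger-order = order-of-product
      (order-of-power (quotient p^a∣m) (subst (HasOrder x) (_∣_.equality p^a∣m) x-ord))
      (order-of-power (p ^ b) (subst (HasOrder g) (trans e≡ (*-comm e′ (p ^ b))) g-ord))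
      (prime-power-coprime p-prime p∤e′ a)

  max-order-below : ∀ k → ∃₂ λ g e → HasOrder g e × (∀ {x} → x < k → ∀ {o} → HasOrder x o → o ≤ e)
  max-order-below zero = 1 , 1 , order-of-one , λ ()
  max-order-below (suc k) with max-order-below k | q ∣? k
  ... | g , e , g-ord , maximal | yes q∣k =
    g , e , g-ord , below-suc maximal λ {_} k-ord → contradiction q∣k (order⇒∤ k-ord)
  ... | g , e , g-ord , maximal | no q∤k with order-exists q∤k
  ...   | o , k-ord , _ with o ≤? e
  ...     | yes o≤e = g , e , g-ord ,
    below-suc maximal λ {_} k-ord′ → ≤-trans (≤-reflexive (order-unique k-ord′ k-ord)) o≤e
  ...     | no  o≰e = k , o , k-ord ,
    below-suc (λ x<k {_} x-ord → ≤-trans (maximal x<k x-ord) (<⇒≤ (≰⇒> o≰e)))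
              (λ {_} k-ord′ → ≤-reflexive (order-unique k-ord′ k-ord))

  opaque
    primitive-root : ∃ λ g → InG q g × HasOrder g (q ∸ 1)
    primitive-root with max-order-below q
    ... | g , e , g-ord , maximal-below-q =
      g % q , ∤⇒InG-% (order⇒∤ g-ord) , subst (HasOrder (g % q)) e≡q∸1 (order-resp-≈ (sym (%-≈ g)) g-ord)
      where
      maximal : ∀ {x o} → HasOrder x o → o ≤ e
      maximal {x} x-ord = maximal-below-q (m%n<n x q) (order-resp-≈ (sym (%-≈ x)) x-ord)
      e<q : e < q
      e<q with order-exists (order⇒∤ g-ord)
      ... | o , g-ord′ , o<q = subst (_< q) (order-unique g-ord′ g-ord) o<q
      unit⇒root : ∀ {x} → q ∤ x → x ^ e ≈ 1
      unit⇒root q∤x with order-exists q∤x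
      ... | _ , x-ord , _ = ∣⇒∈ x-ord (order-∣-max-order g-ord maximal x-ord)
      e≡q∸1 : e ≡ q ∸ 1
      e≡q∸1 = ≤-antisym (∸-monoˡ-≤ 1 e<q) (roots-of-unity-bound (positive g-ord) unit⇒root)

  opaque
    powers-cover : HasOrder g (q ∸ 1) → q ∤ x → ∃ λ n → n < q ∸ 1 × g ^ n ≈ x
    powers-cover {g} {x} g-ord q∤x with units-pigeonhole candidates q∤candidates
      where
      candidates : ℕ → ℕ
      candidates zero    = x
      candidates (suc i) = g ^ i
      q∤candidates : ∀ i → q ∤ candidates i
      q∤candidates zero    = q∤x
      q∤candidates (suc i) = ∤-^ (order⇒∤ g-ord) i
    ... | zero  , suc j , _ , 1+j<q , x≈g^j = j , ∸-monoˡ-≤ 1 1+j<q , sym x≈g^j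
    ... | suc i , suc j , s<s i<j , 1+j<q , g^i≈g^j =
      contradiction g^i≈g^j (pow-distinct g-ord i<j (∸-monoˡ-≤ 1 1+j<q))

  primitive-root⇒IsGenerator : InG q g → HasOrder g (q ∸ 1) → IsGenerator q g
  primitive-root⇒IsGenerator g∈G g-ord = g∈G , λ x x∈G →
    let (n , _ , g^n≈x) = powers-cover g-ord (InG⇒∤ x∈G) in n , ≈⇒≡[mod] g^n≈x

  order-∣-q∸1 : HasOrder x o → o ∣ q ∸ 1
  order-∣-q∸1 {x} x-ord with primitive-root
  ... | g , _ , g-ord with powers-cover g-ord (order⇒∤ x-ord)
  ...   | k , _ , g^k≈x = power-order-∣ k g-ord (order-resp-≈ (sym g^k≈x) x-ord) (n∣m*n k)

-- Primitive roots with a prescribed power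

module PrimitiveRoots {q : ℕ} (q-prime : Prime q) where

  open PrimeModulus q-prime

  -- With N N′ ≡ 1 (mod p), j = N N′ u + p ^ (s + β + 1) is ≡ u mod p and ≡ p ^ (s + β + 1) mod every
  -- prime factor of N; so g ^ j is again of order Q, and j * p ^ s ≡ u * p ^ s = k mod p ^ (s + 1).
  lift-to-primitive-root : Prime p → HasOrder g Q → Q ≡ N * p ^ (s + suc β) → p ∤ N → k ≡ u * p ^ s → p ∤ u →
                           ∃ λ j → HasOrder (g ^ j) Q × ∃ λ t → j * p ^ s ≡ k + t * p ^ suc s
  lift-to-primitive-root {p} {g} {Q} {N} {s} {β} {k} {u} p-prime g-ord Q≡ p∤N k≡ p∤u
    with N′ , t , NN′≡ ← PrimeModulus.∤⇒inverse p-prime p∤N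
    = N * (N′ * u) + p ^ (s + suc β)
    , subst (HasOrder _) (sym Q≡) (order-of-mixed-power {α = s + suc β} p-prime p∤N p∤N′u (subst (HasOrder g) Q≡ g-ord))
    , t * u + A * B , exponent≡
    where
    A B : ℕ
    A = p ^ s
    B = p ^ β
    p∤N′u : p ∤ N′ * u
    p∤N′u p∣N′u with euclidsLemma N′ u p-prime p∣N′u
    ... | inj₂ p∣u  = p∤u p∣u
    ... | inj₁ p∣N′ = prime∤1 p-prime
      (∣m+n∣m⇒∣n (subst (p ∣_) (trans NN′≡ (+-comm 1 (t * p))) (∣n⇒∣m*n N p∣N′)) (n∣m*n t))
    rearrange : ∀ t u A p B → ((1 + t * p) * u + A * (p * B)) * A ≡ u * A + (t * u + A * B) * (p * A)
    rearrange = solve-∀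
    exponent≡ : (N * (N′ * u) + p ^ (s + suc β)) * A ≡ k + (t * u + A * B) * p ^ suc s
    exponent≡ = begin
      (N * (N′ * u) + p ^ (s + suc β)) * A   ≡⟨ cong₂ (λ x y → (x + y) * A) (sym (*-assoc N N′ u))
                                                       (^-distribˡ-+-* p s (suc β)) ⟩
      (N * N′ * u + A * (p * B)) * A         ≡⟨ cong (λ x → (x * u + A * (p * B)) * A) NN′≡ ⟩
      ((1 + t * p) * u + A * (p * B)) * A    ≡⟨ rearrange t u A p B ⟩
      u * A + (t * u + A * B) * (p * A)      ≡⟨ cong (_+ (t * u + A * B) * (p * A)) k≡ ⟨
      k + (t * u + A * B) * p ^ suc s        ∎
      where open ≡-Reasoning

  aligned-exponent : Prime p → HasOrder g (q ∸ 1) → HasOrder (g ^ k) o →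
                     IsVal p (q ∸ 1) (s + suc β) → IsVal p o (suc β) →
                     ∃ λ j → HasOrder (g ^ j) (q ∸ 1) × ∃ λ t → j * p ^ s ≡ k + t * p ^ suc s
  aligned-exponent {p} {g} {k} {o} {s} {β} p-prime g-ord gk-ord Q-val o-val
    with u , k≡ , p∤u ← IsVal⇒cofactor {p} {e = s} (exponent-valuation {s = s} {β = β} p-prime Q-val o-val
                          (∣-power-order k g-ord gk-ord) (power-order-∣ k g-ord gk-ord))
    with N , Q≡ , p∤N ← IsVal⇒cofactor {p} {e = s + suc β} Q-val
    = lift-to-primitive-root {s = s} {β} p-prime g-ord Q≡ p∤N k≡ p∤u

-- The subgroup H

module Subgroup {q : ℕ} (q-prime : Prime q) {H : ℕ → Set} (H≤G : IsSubgroup q H) {m : ℕ} (H-card : HasCard q H m) where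

  open PrimeModulus q-prime
  open PrimitiveRoots q-prime
  open IsSubgroup H≤G renaming (resp to H-resp; inG to H⊆G; one to H-one; mul to H-mul; inv to H-inv)

  private
    elements : List ℕ
    elements = proj₁ H-card
    elements-unique : Unique elements
    elements-unique = proj₁ (proj₂ H-card)
    length-elements : length elements ≡ m
    length-elements = proj₁ (proj₂ (proj₂ H-card))
    ∈-elements : ∀ x → x ∈ elements ⇔ (InG q x × H x)
    ∈-elements = proj₂ (proj₂ (proj₂ H-card))

  H-resp-≈ : x ≈ y → H x → H y
  H-resp-≈ x≈y = H-resp (≈⇒≡[mod] x≈y)

  H? : Decidable H
  H? x with q ∣? x
  ... | yes q∣x = no λ Hx → H⊆G Hx q∣x
  ... | no  q∤x with x % q ∈? elements
  ...   | yes x%q∈ = yes (H-resp-≈ (%-≈ x) (proj₂ (Equivalence.to (∈-elements (x % q)) x%q∈)))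
  ...   | no  x%q∉ = no λ Hx →
    x%q∉ (Equivalence.from (∈-elements (x % q)) (∤⇒InG-% q∤x , H-resp-≈ (sym (%-≈ x)) Hx))

  H-exponents : HasOrder g (q ∸ 1) → ∃ (IsMultiplesOf (λ n → H (g ^ n)))
  H-exponents {g} g-ord = +-∸-closed⇒multiples (λ n → H? (g ^ n)) closed-+ closed-∸
    (m<n⇒0<n∸m (prime⇒>1 q-prime)) (H-resp-≈ (sym (pow-order g-ord)) H-one)
    where
    open ≈-Reasoning
    closed-+ : ∀ a b → H (g ^ a) → H (g ^ b) → H (g ^ (a + b))
    closed-+ a b H[g^a] H[g^b] = subst H (sym (^-distribˡ-+-* g a b)) (H-mul H[g^a] H[g^b])
    closed-∸ : ∀ a b → H (g ^ a) → H (g ^ (a + b)) → H (g ^ b)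
    closed-∸ a b H[g^a] H[g^[a+b]] with H-inv H[g^a]
    ... | y , Hy , g^a*y≡1 = H-resp-≈ (begin
      g ^ (a + b) * y      ≡⟨ cong (_* y) (trans (^-distribˡ-+-* g a b) (*-comm (g ^ a) (g ^ b))) ⟩
      g ^ b * g ^ a * y    ≡⟨ *-assoc (g ^ b) (g ^ a) y ⟩
      g ^ b * (g ^ a * y)  ≈⟨ ≈-* {g ^ b} refl (≡[mod]⇒≈ g^a*y≡1) ⟩
      g ^ b * 1            ≡⟨ *-identityʳ (g ^ b) ⟩
      g ^ b                ∎) (H-mul H[g^[a+b]] Hy)

  -- H consists of the residues g ^ (t * d) for t < (q - 1) / d.
  card*period≡q∸1 : ∀ {d} → HasOrder g (q ∸ 1) → IsMultiplesOf (λ n → H (g ^ n)) d → m * d ≡ q ∸ 1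
  card*period≡q∸1 {g} {d} g-ord H-exp with ∈⇒∣ H-exp {q ∸ 1} (H-resp-≈ (sym (pow-order g-ord)) H-one)
  ... | divides c q∸1≡c*d = trans (cong (_* d) m≡c) (sym q∸1≡c*d)
    where
    instance
      d≢0 : NonZero d
      d≢0 = >-nonZero (positive H-exp)
    representative : ℕ → ℕ
    representative t = g ^ (t * d) % q
    representatives : List ℕ
    representatives = applyUpTo representative c
    representatives-unique : Unique representatives
    representatives-unique = applyUpTo⁺₁ representative c λ {i} {j} i<j j<c →
      pow-distinct g-ord (*-monoˡ-< d i<j) (subst (j * d <_) (sym q∸1≡c*d) (*-monoˡ-< d j<c))
    representatives⊆elements : ∀ {z} → z ∈ representatives → z ∈ elements
    representatives⊆elements z∈ with ∈-applyUpTo⁻ representative z∈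
    ... | t , _ , refl = Equivalence.from (∈-elements _)
      (∤⇒InG-% (∤-^ (order⇒∤ g-ord) (t * d)) , H-resp-≈ (sym (%-≈ _)) (∣⇒∈ H-exp (n∣m*n t)))
    elements⊆representatives : ∀ {z} → z ∈ elements → z ∈ representatives
    elements⊆representatives {z} z∈ with Equivalence.to (∈-elements z) z∈
    ... | z∈G , Hz with powers-cover g-ord (InG⇒∤ z∈G)
    ...   | n , n<q∸1 , g^n≈z with ∈⇒∣ H-exp {n} (H-resp-≈ (sym g^n≈z) Hz)
    ...     | divides t refl = subst (_∈ representatives) (trans g^n≈z (m<n⇒m%n≡m (proj₂ z∈G)))
                (∈-applyUpTo⁺ representative (*-cancelʳ-< d t c (subst (t * d <_) q∸1≡c*d n<q∸1)))
    m≡c : m ≡ c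
    m≡c = trans (sym length-elements) (trans
      (≤-antisym (unique-⊆⇒length≤ elements-unique elements⊆representatives)
                 (unique-⊆⇒length≤ representatives-unique representatives⊆elements))
      (length-applyUpTo representative c))

  module Index {P : ℕ} (m*P≡q∸1 : m * P ≡ q ∸ 1) where

    instance
      P≢0 : NonZero P
      P≢0 = ≢-nonZero λ { refl → <⇒≢ (m<n⇒0<n∸m (prime⇒>1 q-prime)) (trans (sym (*-zeroʳ m)) m*P≡q∸1) }

    P∣q∸1 : P ∣ q ∸ 1
    P∣q∸1 = divides m (sym m*P≡q∸1)

    H-exponents-are-multiples : HasOrder g (q ∸ 1) → IsMultiplesOf (λ n → H (g ^ n)) P
    H-exponents-are-multiples g-ord with H-exponents g-ord
    ... | d , H-exp = subst (IsMultiplesOf _) (sym P≡d) H-exp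
      where
      m≢0 : NonZero m
      m≢0 = m*n≢0⇒m≢0 m {{≢-nonZero (<⇒≢ (m<n⇒0<n∸m (prime⇒>1 q-prime)) ∘ sym ∘ trans (sym m*P≡q∸1))}}
      P≡d : P ≡ d
      P≡d = *-cancelˡ-≡ P d m {{m≢0}} (trans m*P≡q∸1 (sym (card*period≡q∸1 g-ord H-exp)))

    aligned-generator′ : Prime p → P ≡ p ^ suc s → HasOrder a o →
                         IsVal p (q ∸ 1) (s + suc β) → IsVal p o (suc β) →
                         ∃ λ g → InG q g × HasOrder g (q ∸ 1) × SameCoset q H (g ^ p ^ s) a
    aligned-generator′ {p} {s} {a} {o} {β} p-prime P≡ a-ord Q-val o-val with primitive-root
    ... | g₀ , _ , g₀-ord with powers-cover g₀-ord (order⇒∤ a-ord)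
    ...   | k , _ , g₀^k≈a
      with aligned-exponent {s = s} {β} p-prime g₀-ord (order-resp-≈ (sym g₀^k≈a) a-ord) Q-val o-val
    ...     | j , g₀^j-ord , t , j*p^s≡ =
      g₀ ^ j % q , ∤⇒InG-% (order⇒∤ g₀^j-ord) , order-resp-≈ (sym (%-≈ _)) g₀^j-ord ,
      g₀ ^ (t * P) , ∣⇒∈ (H-exponents-are-multiples g₀-ord) (n∣m*n t) , ≈⇒≡[mod] g^p^s≈a*h
      where
      g^p^s≈a*h : (g₀ ^ j % q) ^ p ^ s ≈ a * g₀ ^ (t * P)
      g^p^s≈a*h = begin
        (g₀ ^ j % q) ^ p ^ s        ≈⟨ ≈-^ (%-≈ (g₀ ^ j)) (p ^ s) ⟩
        (g₀ ^ j) ^ p ^ s            ≡⟨ ^-*-assoc g₀ j (p ^ s) ⟩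
        g₀ ^ (j * p ^ s)            ≡⟨ cong (g₀ ^_) (trans j*p^s≡ (cong (λ P → k + t * P) (sym P≡))) ⟩
        g₀ ^ (k + t * P)            ≡⟨ ^-distribˡ-+-* g₀ k (t * P) ⟩
        g₀ ^ k * g₀ ^ (t * P)       ≈⟨ ≈-* g₀^k≈a refl ⟩
        a * g₀ ^ (t * P)            ∎
        where open ≈-Reasoning

    aligned-generator : Prime p → P ≡ p ^ (α ∸ β + 1) → HasOrder a o → p ∣ o →
                        IsVal p (q ∸ 1) α → IsVal p o β →
                        ∃ λ g → InG q g × HasOrder g (q ∸ 1) × SameCoset q H (g ^ p ^ (α ∸ β)) a
    aligned-generator {β = zero} _ _ _ p∣o _ (_ , p∤o) = contradiction (subst (_∣ _) (sym (*-identityʳ _)) p∣o) p∤o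
    aligned-generator {p} {α} {suc β} p-prime P≡ a-ord _ Q-val o-val = aligned-generator′ {s = α ∸ suc β} {β = β}
      p-prime (trans P≡ (cong (p ^_) (+-comm (α ∸ suc β) 1))) a-ord (subst (IsVal p (q ∸ 1)) (sym α≡) Q-val) o-val
      where
      α≡ : α ∸ suc β + suc β ≡ α
      α≡ = m∸n+n≡m (IsVal-∣⇒≤ {α = α} {β = suc β} (order-∣-q∸1 a-ord) Q-val o-val)

    private module ModP = Congruence P

    φ-well-defined : HasOrder g (q ∸ 1) → ∀ n n′ → n ≡ n′ [mod P ] → SameCoset q H (g ^ n) (g ^ n′)
    φ-well-defined {g} g-ord n n′ n≡n′ =
      g ^ δ , ∣⇒∈ (H-exponents-are-multiples g-ord) (ModP.≈0⇒∣ δ≈0) , ≈⇒≡[mod] (sym g^n′*g^δ≈g^n)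
      where
      -- δ stands for n - n′, shifted by a multiple of q - 1 so that it is a natural number.
      δ : ℕ
      δ = n + (q ∸ 1 ∸ 1) * n′
      n′+δ≡ : n′ + δ ≡ n + (q ∸ 1) * n′
      n′+δ≡ = trans (+-comm n′ δ) (trans (+-assoc n _ n′) (cong (n +_) (trans (+-comm _ n′)
        (cong (_* n′) (m+[n∸m]≡n {1} (m<n⇒0<n∸m (prime⇒>1 q-prime)))))))
      δ≈0 : δ ModP.≈ 0
      δ≈0 = ModP.+-cancelˡ-≈ n′ (begin
        n′ + δ                  ≡⟨ n′+δ≡ ⟩
        n + (q ∸ 1) * n′        ≈⟨ ModP.≈-+ {n} refl (ModP.∣⇒≈0 (∣m⇒∣m*n n′ P∣q∸1)) ⟩
        n + 0                   ≡⟨ +-identityʳ n ⟩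
        n                       ≈⟨ ModP.≡[mod]⇒≈ n≡n′ ⟩
        n′                      ≡⟨ +-identityʳ n′ ⟨
        n′ + 0                  ∎)
        where open ModP.≈-Reasoning
      g^n′*g^δ≈g^n : g ^ n′ * g ^ δ ≈ g ^ n
      g^n′*g^δ≈g^n = begin
        g ^ n′ * g ^ δ               ≡⟨ ^-distribˡ-+-* g n′ δ ⟨
        g ^ (n′ + δ)                 ≡⟨ cong (g ^_) n′+δ≡ ⟩
        g ^ (n + (q ∸ 1) * n′)       ≡⟨ ^-distribˡ-+-* g n _ ⟩
        g ^ n * g ^ ((q ∸ 1) * n′)   ≈⟨ ≈-* {g ^ n} refl (∣⇒∈ g-ord (m∣m*n n′)) ⟩
        g ^ n * 1                    ≡⟨ *-identityʳ (g ^ n) ⟩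
        g ^ n                        ∎
        where open ≈-Reasoning

    φ-homomorphism : ∀ n n′ → SameCoset q H (g ^ (n + n′)) (g ^ n * g ^ n′)
    φ-homomorphism {g} n n′ =
      1 , H-one , ≈⇒≡[mod] (cong (_% q) (trans (^-distribˡ-+-* g n n′) (sym (*-identityʳ _))))

    φ-injective : HasOrder g (q ∸ 1) → ∀ n n′ → SameCoset q H (g ^ n) (g ^ n′) → n ≡ n′ [mod P ]
    φ-injective {g} g-ord n n′ (h , Hh , g^n≡g^n′*h) with powers-cover g-ord (H⊆G Hh)
    ... | s , _ , g^s≈h = ModP.≈⇒≡[mod] (begin
      n         ≈⟨ ModP.∣∣-∣⇒≈ (∣-trans P∣q∸1 (pow-≈⇒order-∣ {i = n} {j = n′ + s} g-ord g^n≈g^[n′+s])) ⟩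
      n′ + s    ≈⟨ ModP.≈-+ {n′} refl (ModP.∣⇒≈0 P∣s) ⟩
      n′ + 0    ≡⟨ +-identityʳ n′ ⟩
      n′        ∎)
      where
      open ModP.≈-Reasoning
      P∣s : P ∣ s
      P∣s = ∈⇒∣ (H-exponents-are-multiples g-ord) {s} (H-resp-≈ (sym g^s≈h) Hh)
      g^n≈g^[n′+s] : g ^ n ≈ g ^ (n′ + s)
      g^n≈g^[n′+s] = trans (≡[mod]⇒≈ g^n≡g^n′*h) (trans (≈-* {g ^ n′} refl (sym g^s≈h))
        (cong (_% q) (sym (^-distribˡ-+-* g n′ s))))

    φ-surjective : HasOrder g (q ∸ 1) → ∀ x → InG q x → Σ ℕ λ n → SameCoset q H (g ^ n) x
    φ-surjective g-ord x x∈G with powers-cover g-ord (InG⇒∤ x∈G)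
    ... | n , _ , g^n≈x = n , 1 , H-one , ≈⇒≡[mod] (trans g^n≈x (cong (_% q) (sym (*-identityʳ x))))

    φ-isomorphism : HasOrder g (q ∸ 1) → IsIsoPhi q H P g
    φ-isomorphism {g} g-ord = φ-well-defined g-ord , φ-homomorphism {g} , φ-injective g-ord , φ-surjective g-ord

lemma7 : (q : ℕ) → Prime q → (a : ℕ) → InG q a → ¬ (a ≡ 1) →
    (P p r : ℕ) → IsScriptP q a P → Prime p → P ≡ p ^ r →
    (H : ℕ → Set) → IsSubgroup q H → (m : ℕ) → m * P ≡ q ∸ 1 → HasCard q H m →
    Σ ℕ λ g → IsGenerator q g × IsIsoPhi q H P g ×
      SameCoset q H (g ^ (p ^ (r ∸ 1))) a
lemma7 q q-prime a _ _ P p r (o , a-ord , (p′ , α , β , p′-prime , p′∣o , Q-val , o-val , P≡p′^) , _)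
       p-prime P≡p^r H H≤G m m*P≡q∸1 H-card =
  case aligned-generator {α = α} {β} p′-prime P≡p′^ (IsOrd⇒HasOrder a-ord) p′∣o Q-val o-val of λ where
    (g , g∈G , g-ord , coset) → g , primitive-root⇒IsGenerator g∈G g-ord , φ-isomorphism g-ord ,
      subst (λ e → SameCoset q H (g ^ e) a) (cong₂ _^_ p′≡p r∸1≡) coset
  where
  open PrimeModulus q-prime
  open Subgroup q-prime H≤G H-card
  open Index m*P≡q∸1
  p′≡p : p′ ≡ p
  p′≡p = prime-power-base-unique {a = α ∸ β} {r} p′-prime p-prime (trans (sym P≡p′^) P≡p^r)
  r∸1≡ : α ∸ β ≡ r ∸ 1
  r∸1≡ = trans (sym (m+n∸n≡m (α ∸ β) 1)) (cong (_∸ 1) (^-injective {a = α ∸ β + 1} {r} (prime⇒>1 p-prime)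
    (trans (sym (subst (λ ℓ → P ≡ ℓ ^ (α ∸ β + 1)) p′≡p P≡p′^)) P≡p^r)))
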